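{- Let $n\ge1$ be an integer and let $A_{ij}$ be the coefficient of $u^iv^jw^{n-i-j}$ in the numerator $P_{1/n}(u,v,w)$ of the Markov polynomial $M_{1/n}$. Then for integers $i,j$, $A_{ij}\neq0$ if and only if $i\ge0$, $j\ge0$, $i+\frac{j}{n}\ge1$ and $i+j\le n$.
   Context: Markov polynomials $M_\rho(x,y,z)$, $\rho\in\mathbb{Q}_{\ge0}\cup\{1/0\}$, are defined recursively by $M_{0/1}=x$, $M_{1/0}=y$, $M_{1/1}=(x^2+y^2)/z$, and: whenever $p/q$, $r/s$ are fractions in lowest terms with $p,q,r,s\ge0$, $qr-ps=1$, mediant $\mu=(p+r)/(q+s)$, then $M_{(2p+r)/(2q+s)}=(M_{p/q}^2+M_\mu^2)/M_{r/s}$ and $M_{(p+2r)/(q+2s)}=(M_\mu^2+M_{r/s}^2)/M_{p/q}$. For coprime positive $a,b$, $M_{a/b}=P_{a/b}(x^2,y^2,z^2)/(x^{a-1}y^{b-1}z^{a+b-1})$ with $P_{a/b}(u,v,w)$ homogeneous of degree $a+b-1$ (the numerator). -}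

module Defs where

open import Data.Nat as ℕ using (ℕ; zero; suc; _∸_; _≤?_)
open import Data.Nat.Properties using (_≟_)
open import Data.Integer as ℤ using (ℤ; +_; 0ℤ; 1ℤ)
open import Data.Bool using (Bool; true; false; _∧_; if_then_else_)
open import Data.Product using (_×_)
open import Relation.Nullary using (does; yes; no)
open import Relation.Binary.PropositionalEquality using (_≡_)

-- Formal power series / polynomials in three commuting variables u, v, w
-- with integer coefficients: (p a b c) is the coefficient of u^a v^b w^c.
Poly : Set
Poly = ℕ → ℕ → ℕ → ℤ

_≋_ : Poly → Poly → Set
p ≋ q = ∀ a b c → p a b c ≡ q a b c

infix 4 _≋_
infixl 6 _+ₚ_
infixl 7 _*ₚ_

sumTo : ℕ → (ℕ → ℤ) → ℤ
sumTo zero    f = f 0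
sumTo (suc n) f = sumTo n f ℤ.+ f (suc n)

_+ₚ_ : Poly → Poly → Poly
(p +ₚ q) a b c = p a b c ℤ.+ q a b c

_*ₚ_ : Poly → Poly → Poly
(p *ₚ q) a b c =
  sumTo a λ a₁ → sumTo b λ b₁ → sumTo c λ c₁ →
    p a₁ b₁ c₁ ℤ.* q (a ∸ a₁) (b ∸ b₁) (c ∸ c₁)

mono : ℕ → ℕ → ℕ → Poly
mono i j k a b c =
  if does (a ≟ i) ∧ does (b ≟ j) ∧ does (c ≟ k) then 1ℤ else 0ℤ

-- P is the sequence of numerators P n = P_{1/n}(u,v,w) of the Markov
-- polynomials M_{1/n} = P_{1/n}(x²,y²,z²)/(y^{n-1} z^n):
--   P 0 = 1            (from M_{1/0} = y)
--   P 1 = u + v        (from M_{1/1} = (x²+y²)/z)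
--   P (n+2) · P n = u v^n w^(n+1) + P(n+1)²
--     (from M_{1/(n+2)} = (M_{0/1}² + M_{1/(n+1)}²)/M_{1/n}, the defining
--      recursion applied to the Farey neighbours 0/1, 1/n).
-- Since ℤ[[u,v,w]] is an integral domain, these conditions determine P.
IsMarkovNumerator1n : (ℕ → Poly) → Set
IsMarkovNumerator1n P =
  (P 0 ≋ mono 0 0 0) ×
  (P 1 ≋ mono 1 0 0 +ₚ mono 0 1 0) ×
  (∀ n → P (suc (suc n)) *ₚ P n ≋ mono 1 n (suc n) +ₚ P (suc n) *ₚ P (suc n))

coeffA : (ℕ → Poly) → ℕ → ℤ → ℤ → ℤ
coeffA P n (+ i) (+ j) with (i ℕ.+ j) ≤? n
... | yes _ = P n i j (n ∸ (i ℕ.+ j))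
... | no  _ = 0ℤ
coeffA P n _ _ = 0ℤ

-- Define Q_n, R_n ∈ ℤ[[u,v,w]] by the first-order system
--   Q₀ = 1,  R₀ = 0,  Q_{n+1} = v Q_n + R_{n+1},  R_{n+1} = u Q_n + w R_n.
-- Its coefficients are natural numbers, so the support of Q_n can be read off by induction:
-- a monomial u^a v^b w^c of degree n occurs iff a ≥ 1 or b = n.  Eliminating R gives the
-- linear recurrence Q_{n+2} + vw Q_n = (u+v+w) Q_{n+1}, along which the Casoratian
-- Q_{n+2}Q_n − Q_{n+1}² (equal to uw at n = 0) is multiplied by vw at each step; hence
-- Q_{n+2}Q_n = u vⁿ wⁿ⁺¹ + Q_{n+1}², the defining recursion of the numerators P_{1/n}.
-- That recursion determines the sequence from its first two terms, because every Q_n is a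
-- non-zero-divisor of ℤ[[u,v,w]]; so P_{1/n} = Q_n.
module Submission where

open import Defs
open import Algebra.Bundles using (CommutativeRing)
open import Algebra.Structures using (IsAbelianGroup)
open import Data.Bool using (if_then_else_; _∧_)
open import Data.Bool.Properties using (∧-zeroʳ)
open import Data.Integer as ℤ using (ℤ; +_; -[1+_]; 0ℤ; 1ℤ; +≤+)
open import Data.Integer.Properties as ℤ using (+-*-commutativeRing)
open import Data.Nat using (ℕ)
open import Data.Nat as ℕ using (zero; suc; _∸_; z≤n; s≤s)
open import Data.Nat.Induction using (<-rec)
open import Data.Nat.Properties as ℕ using (_≟_)
open import Data.Product using (_×_; _,_; proj₁)
open import Data.Sum as Sum using (_⊎_; inj₁; inj₂)
open import Function using (_∘_)
open import Function.Bundles using (_⇔_; mk⇔; Equivalence)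
open import Function.Construct.Composition using (_⇔-∘_)
open import Level using (_⊔_)
open import Relation.Nullary using (¬_; yes; no; does; contradiction)
open import Relation.Binary.Definitions using (tri<; tri≈; tri>)
open import Relation.Binary.PropositionalEquality as ≡ using (_≡_; _≢_; ≢-sym)

NonZeroDivisor : ∀ {c ℓ} (R : CommutativeRing c ℓ) → CommutativeRing.Carrier R → Set (c ⊔ ℓ)
NonZeroDivisor R g = ∀ x → x * g ≈ 0# → x ≈ 0#
  where open CommutativeRing R

module ExchangeRecurrence {c ℓ} (R : CommutativeRing c ℓ) where

  open CommutativeRing R
  open import Relation.Binary.Reasoning.Setoid setoid
  open import Algebra.Properties.Group +-group using (∙-cancelʳ; x∙y⁻¹≈ε⇒x≈y)
  open import Algebra.Properties.Ring ring using (-‿distribˡ-*)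
  open import Algebra.Solver.Ring.NaturalCoefficients.Default commutativeSemiring

  IsExchangeSequence : (ℕ → Carrier) → (ℕ → Carrier) → Set ℓ
  IsExchangeSequence c X = ∀ n → X (suc (suc n)) * X n ≈ c n + X (suc n) * X (suc n)

  -- X₃X₁ − X₂² = d (X₂X₀ − X₁²): the Casoratian is multiplied by d at each step.
  linear⇒exchange : ∀ {t d c X} →
    (∀ n → X (suc (suc n)) + d * X n ≈ t * X (suc n)) → (∀ n → c (suc n) ≈ d * c n) →
    X 2 * X 0 ≈ c 0 + X 1 * X 1 → IsExchangeSequence c X
  linear⇒exchange linear c-step base zero = base
  linear⇒exchange {t} {d} {c} {X} linear c-step base (suc n) =
    ∙-cancelʳ (d * (X₁ * X₁)) _ _ (begin
      X₃ * X₁ + d * (X₁ * X₁)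
        ≈⟨ solve 3 (λ X₃ X₁ d → X₃ :* X₁ :+ d :* (X₁ :* X₁) := (X₃ :+ d :* X₁) :* X₁) refl X₃ X₁ d ⟩
      (X₃ + d * X₁) * X₁
        ≈⟨ *-congʳ (linear (suc n)) ⟩
      (t * X₂) * X₁
        ≈⟨ solve 3 (λ t X₂ X₁ → (t :* X₂) :* X₁ := X₂ :* (t :* X₁)) refl t X₂ X₁ ⟩
      X₂ * (t * X₁)
        ≈⟨ *-congˡ (linear n) ⟨
      X₂ * (X₂ + d * X₀)
        ≈⟨ solve 3 (λ X₂ d X₀ → X₂ :* (X₂ :+ d :* X₀) := X₂ :* X₂ :+ d :* (X₂ :* X₀)) refl X₂ d X₀ ⟩
      X₂ * X₂ + d * (X₂ * X₀)
        ≈⟨ +-congˡ (*-congˡ (linear⇒exchange linear c-step base n)) ⟩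
      X₂ * X₂ + d * (c n + X₁ * X₁)
        ≈⟨ solve 4 (λ X₂ d k X₁ → X₂ :* X₂ :+ d :* (k :+ X₁ :* X₁)
                                := (d :* k :+ X₂ :* X₂) :+ d :* (X₁ :* X₁))
                   refl X₂ d (c n) X₁ ⟩
      (d * c n + X₂ * X₂) + d * (X₁ * X₁)
        ≈⟨ +-congʳ (+-congʳ (c-step n)) ⟨
      (c (suc n) + X₂ * X₂) + d * (X₁ * X₁)
        ∎)
    where
    X₀ X₁ X₂ X₃ : Carrier
    X₀ = X n
    X₁ = X (suc n)
    X₂ = X (suc (suc n))
    X₃ = X (suc (suc (suc n)))

  nonZeroDivisor-cancelʳ : ∀ {g x y} → NonZeroDivisor R g → x * g ≈ y * g → x ≈ y
  nonZeroDivisor-cancelʳ {g} {x} {y} nzd xg≈yg = x∙y⁻¹≈ε⇒x≈y x y (nzd (x - y) (begin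
    (x - y) * g        ≈⟨ distribʳ g x (- y) ⟩
    x * g + (- y) * g  ≈⟨ +-cong xg≈yg (sym (-‿distribˡ-* y g)) ⟩
    y * g - y * g      ≈⟨ -‿inverseʳ (y * g) ⟩
    0#                 ∎))

  exchange-unique : ∀ {c X Y} → IsExchangeSequence c X → IsExchangeSequence c Y →
    X 0 ≈ Y 0 → X 1 ≈ Y 1 → (∀ n → NonZeroDivisor R (Y n)) → ∀ n → X n ≈ Y n
  exchange-unique {c} {X} {Y} exchangeX exchangeY X₀≈Y₀ X₁≈Y₁ nzd n = proj₁ (consecutive n)
    where
    consecutive : ∀ n → X n ≈ Y n × X (suc n) ≈ Y (suc n)
    consecutive zero    = X₀≈Y₀ , X₁≈Y₁
    consecutive (suc n) with consecutive n
    ... | Xₙ≈Yₙ , Xₙ₊₁≈Yₙ₊₁ = Xₙ₊₁≈Yₙ₊₁ , nonZeroDivisor-cancelʳ (nzd n) (begin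
      X (suc (suc n)) * Y n        ≈⟨ *-congˡ Xₙ≈Yₙ ⟨
      X (suc (suc n)) * X n        ≈⟨ exchangeX n ⟩
      c n + X (suc n) * X (suc n)  ≈⟨ +-congˡ (*-cong Xₙ₊₁≈Yₙ₊₁ Xₙ₊₁≈Yₙ₊₁) ⟩
      c n + Y (suc n) * Y (suc n)  ≈⟨ exchangeY n ⟨
      Y (suc (suc n)) * Y n        ∎)

  module FirstOrderSystem {u v w : Carrier} {Q R : ℕ → Carrier}
    (Q-step : ∀ n → Q (suc n) ≈ v * Q n + R (suc n))
    (R-step : ∀ n → R (suc n) ≈ u * Q n + w * R n)
    (Q₀≈1 : Q 0 ≈ 1#) (R₀≈0 : R 0 ≈ 0#)
    where

    R₁≈u : R 1 ≈ u
    R₁≈u = begin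
      R 1                ≈⟨ R-step 0 ⟩
      u * Q 0 + w * R 0  ≈⟨ +-cong (*-congˡ Q₀≈1) (*-congˡ R₀≈0) ⟩
      u * 1# + w * 0#    ≈⟨ solve 2 (λ u w → u :* con 1 :+ w :* con 0 := u) refl u w ⟩
      u                  ∎

    Q₁≈u+v : Q 1 ≈ u + v
    Q₁≈u+v = begin
      Q 1            ≈⟨ Q-step 0 ⟩
      v * Q 0 + R 1  ≈⟨ +-cong (*-congˡ Q₀≈1) R₁≈u ⟩
      v * 1# + u     ≈⟨ solve 2 (λ u v → v :* con 1 :+ u := u :+ v) refl u v ⟩
      u + v          ∎

    Q-linear : ∀ n → Q (suc (suc n)) + (v * w) * Q n ≈ (u + v + w) * Q (suc n)
    Q-linear n = begin
      Q₂ + (v * w) * Q₀                            ≈⟨ +-congʳ (Q-step (suc n)) ⟩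
      (v * Q₁ + R₂) + (v * w) * Q₀                 ≈⟨ +-congʳ (+-congˡ (R-step (suc n))) ⟩
      (v * Q₁ + (u * Q₁ + w * R₁)) + (v * w) * Q₀
        ≈⟨ solve 6 (λ u v w Q₀ Q₁ R₁ → (v :* Q₁ :+ (u :* Q₁ :+ w :* R₁)) :+ (v :* w) :* Q₀
                                      := (u :+ v) :* Q₁ :+ w :* (v :* Q₀ :+ R₁))
                   refl u v w Q₀ Q₁ R₁ ⟩
      (u + v) * Q₁ + w * (v * Q₀ + R₁)             ≈⟨ +-congˡ (*-congˡ (Q-step n)) ⟨
      (u + v) * Q₁ + w * Q₁                        ≈⟨ distribʳ Q₁ (u + v) w ⟨
      (u + v + w) * Q₁                             ∎
      where
      Q₀ Q₁ Q₂ R₁ R₂ : Carrier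
      Q₀ = Q n
      Q₁ = Q (suc n)
      Q₂ = Q (suc (suc n))
      R₁ = R (suc n)
      R₂ = R (suc (suc n))

    Q-exchange : ∀ {c} → c 0 ≈ w * u → (∀ n → c (suc n) ≈ (v * w) * c n) → IsExchangeSequence c Q
    Q-exchange {c} c₀≈wu c-step = linear⇒exchange Q-linear c-step (begin
      Q 2 * Q 0                               ≈⟨ *-cong (Q-step 1) Q₀≈1 ⟩
      (v * Q 1 + R 2) * 1#                    ≈⟨ *-congʳ (+-congˡ (R-step 1)) ⟩
      (v * Q 1 + (u * Q 1 + w * R 1)) * 1#
        ≈⟨ *-congʳ (+-cong (*-congˡ Q₁≈u+v) (+-cong (*-congˡ Q₁≈u+v) (*-congˡ R₁≈u))) ⟩
      (v * (u + v) + (u * (u + v) + w * u)) * 1#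
        ≈⟨ solve 3 (λ u v w → (v :* (u :+ v) :+ (u :* (u :+ v) :+ w :* u)) :* con 1
                              := w :* u :+ (u :+ v) :* (u :+ v))
                   refl u v w ⟩
      w * u + (u + v) * (u + v)               ≈⟨ +-cong c₀≈wu (*-cong Q₁≈u+v Q₁≈u+v) ⟨
      c 0 + Q 1 * Q 1                         ∎)

module PowerSeries {c ℓ} (R : CommutativeRing c ℓ) where

  open import Data.Nat using (_≤_; _<_)
  open CommutativeRing R
  open import Relation.Binary.Reasoning.Setoid setoid
  open import Algebra.Properties.CommutativeSemigroup +-commutativeSemigroup using (interchange)

  Series : Set c
  Series = ℕ → Carrier

  _≐_ : Series → Series → Set ℓ
  f ≐ g = ∀ n → f n ≈ g n

  -- A record rather than _≐_ itself, so that Agda can infer the two sides of a ring equality.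
  record _≈ₛ_ (f g : Series) : Set ℓ where
    constructor coefficientwise
    field coefficient : f ≐ g
  open _≈ₛ_ public

  ∑ : ℕ → (ℕ → Carrier) → Carrier
  ∑ zero    f = f 0
  ∑ (suc n) f = ∑ n f + f (suc n)

  ∑-cong : ∀ n {f g} → (∀ i → i ≤ n → f i ≈ g i) → ∑ n f ≈ ∑ n g
  ∑-cong zero    f≈g = f≈g 0 z≤n
  ∑-cong (suc n) f≈g = +-cong (∑-cong n λ i i≤n → f≈g i (ℕ.m≤n⇒m≤1+n i≤n)) (f≈g (suc n) ℕ.≤-refl)

  ∑-distrib-+ : ∀ n f g → ∑ n (λ i → f i + g i) ≈ ∑ n f + ∑ n g
  ∑-distrib-+ zero    f g = refl
  ∑-distrib-+ (suc n) f g = trans (+-congʳ (∑-distrib-+ n f g)) (interchange _ _ _ _)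

  ∑-distribˡ-* : ∀ n x f → x * ∑ n f ≈ ∑ n (λ i → x * f i)
  ∑-distribˡ-* zero    x f = refl
  ∑-distribˡ-* (suc n) x f = trans (distribˡ _ _ _) (+-congʳ (∑-distribˡ-* n x f))

  ∑-head : ∀ n f → ∑ (suc n) f ≈ f 0 + ∑ n (λ i → f (suc i))
  ∑-head zero    f = refl
  ∑-head (suc n) f = trans (+-congʳ (∑-head n f)) (+-assoc _ _ _)

  ∑-zero : ∀ n f → (∀ i → i ≤ n → f i ≈ 0#) → ∑ n f ≈ 0#
  ∑-zero zero    f f≈0 = f≈0 0 z≤n
  ∑-zero (suc n) f f≈0 =
    trans (+-cong (∑-zero n f λ i i≤n → f≈0 i (ℕ.m≤n⇒m≤1+n i≤n)) (f≈0 (suc n) ℕ.≤-refl)) (+-identityˡ 0#)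

  ∑-single : ∀ n k f → k ≤ n → (∀ i → i ≤ n → i ≢ k → f i ≈ 0#) → ∑ n f ≈ f k
  ∑-single zero    zero f _ _ = refl
  ∑-single (suc n) k    f k≤1+n others with ℕ.m≤n⇒m<n∨m≡n k≤1+n
  ... | inj₁ (s≤s k≤n) = begin
    ∑ n f + f (suc n)  ≈⟨ +-congˡ (others (suc n) ℕ.≤-refl (≢-sym (ℕ.<⇒≢ (s≤s k≤n)))) ⟩
    ∑ n f + 0#         ≈⟨ +-identityʳ _ ⟩
    ∑ n f              ≈⟨ ∑-single n k f k≤n (λ i i≤n → others i (ℕ.m≤n⇒m≤1+n i≤n)) ⟩
    f k                ∎
  ... | inj₂ ≡.refl = begin
    ∑ n f + f (suc n)  ≈⟨ +-congʳ (∑-zero n f λ i i≤n → others i (ℕ.m≤n⇒m≤1+n i≤n) (ℕ.<⇒≢ (s≤s i≤n))) ⟩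
    0# + f (suc n)     ≈⟨ +-identityˡ _ ⟩
    f (suc n)          ∎

  X : Series
  X 1 = 1#
  X _ = 0#

  C : Carrier → Series
  C x zero    = x
  C x (suc _) = 0#

  shift : Series → Series
  shift f zero    = 0#
  shift f (suc n) = f n

  tail : Series → Series
  tail f n = f (suc n)

  _⊕_ : Series → Series → Series
  (f ⊕ g) n = f n + g n

  ⊝_ : Series → Series
  (⊝ f) n = - f n

  _⊛_ : Series → Series → Series
  (f ⊛ g) n = ∑ n λ i → f i * g (n ∸ i)

  ⊛-cong : ∀ {f f′ g g′} → f ≐ f′ → g ≐ g′ → (f ⊛ g) ≐ (f′ ⊛ g′)
  ⊛-cong f≐f′ g≐g′ n = ∑-cong n λ i _ → *-cong (f≐f′ i) (g≐g′ (n ∸ i))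

  ⊛-suc : ∀ f g n → (f ⊛ g) (suc n) ≈ f 0 * g (suc n) + (tail f ⊛ g) n
  ⊛-suc f g n = ∑-head n λ i → f i * g (suc n ∸ i)

  ⊛-sucʳ : ∀ f g n → (f ⊛ g) (suc n) ≈ (f ⊛ tail g) n + f (suc n) * g 0
  ⊛-sucʳ f g n = +-cong (∑-cong n λ i i≤n → reflexive (≡.cong (λ k → f i * g k) (ℕ.+-∸-assoc 1 i≤n)))
                        (reflexive (≡.cong (λ k → f (suc n) * g k) (ℕ.n∸n≡0 n)))

  ⊛-comm : ∀ f g → (f ⊛ g) ≐ (g ⊛ f)
  ⊛-comm f g zero    = *-comm _ _
  ⊛-comm f g (suc n) = begin
    (f ⊛ g) (suc n)                   ≈⟨ ⊛-suc f g n ⟩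
    f 0 * g (suc n) + (tail f ⊛ g) n  ≈⟨ +-cong (*-comm _ _) (⊛-comm (tail f) g n) ⟩
    g (suc n) * f 0 + (g ⊛ tail f) n  ≈⟨ +-comm _ _ ⟩
    (g ⊛ tail f) n + g (suc n) * f 0  ≈⟨ ⊛-sucʳ g f n ⟨
    (g ⊛ f) (suc n)                   ∎

  ⊛-distribˡ : ∀ h f g → (h ⊛ (f ⊕ g)) ≐ ((h ⊛ f) ⊕ (h ⊛ g))
  ⊛-distribˡ h f g n = trans (∑-cong n λ i _ → distribˡ _ _ _) (∑-distrib-+ n _ _)

  ⊛-distribʳ : ∀ h f g → ((f ⊕ g) ⊛ h) ≐ ((f ⊛ h) ⊕ (g ⊛ h))
  ⊛-distribʳ h f g n = trans (∑-cong n λ i _ → distribʳ _ _ _) (∑-distrib-+ n _ _)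

  C-⊛ : ∀ x f → (C x ⊛ f) ≐ λ n → x * f n
  C-⊛ x f n = ∑-single n 0 _ z≤n λ where
    zero    _ 0≢0 → contradiction ≡.refl 0≢0
    (suc i) _ _   → zeroˡ _

  X-⊛ : ∀ f → (X ⊛ f) ≐ shift f
  X-⊛ f zero    = zeroˡ _
  X-⊛ f (suc n) = trans (∑-single (suc n) 1 _ (s≤s z≤n) others) (*-identityˡ (f n))
    where
    others : ∀ i → i ≤ suc n → i ≢ 1 → X i * f (suc n ∸ i) ≈ 0#
    others zero          _ _   = zeroˡ _
    others (suc zero)    _ 1≢1 = contradiction ≡.refl 1≢1
    others (suc (suc i)) _ _   = zeroˡ _

  ⊛-identityˡ : ∀ f → (C 1# ⊛ f) ≐ f
  ⊛-identityˡ f n = trans (C-⊛ 1# f n) (*-identityˡ _)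

  ⊛-assoc : ∀ f g h → ((f ⊛ g) ⊛ h) ≐ (f ⊛ (g ⊛ h))
  ⊛-assoc f g h zero    = *-assoc _ _ _
  ⊛-assoc f g h (suc n) = begin
    ((f ⊛ g) ⊛ h) (suc n)
      ≈⟨ ⊛-suc (f ⊛ g) h n ⟩
    (f 0 * g 0) * h (suc n) + (tail (f ⊛ g) ⊛ h) n
      ≈⟨ +-congˡ (⊛-cong {g = h} (⊛-suc f g) (λ _ → refl) n) ⟩
    (f 0 * g 0) * h (suc n) + (((f 0 *ₗ tail g) ⊕ (tail f ⊛ g)) ⊛ h) n
      ≈⟨ +-congˡ (⊛-distribʳ h _ _ n) ⟩
    (f 0 * g 0) * h (suc n) + (((f 0 *ₗ tail g) ⊛ h) n + ((tail f ⊛ g) ⊛ h) n)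
      ≈⟨ +-congˡ (+-cong (trans (∑-cong n λ i _ → *-assoc _ _ _) (sym (∑-distribˡ-* n _ _)))
                         (⊛-assoc (tail f) g h n)) ⟩
    (f 0 * g 0) * h (suc n) + (f 0 * (tail g ⊛ h) n + (tail f ⊛ (g ⊛ h)) n)
      ≈⟨ +-assoc _ _ _ ⟨
    ((f 0 * g 0) * h (suc n) + f 0 * (tail g ⊛ h) n) + (tail f ⊛ (g ⊛ h)) n
      ≈⟨ +-congʳ (trans (+-congʳ (*-assoc _ _ _)) (sym (distribˡ _ _ _))) ⟩
    f 0 * (g 0 * h (suc n) + (tail g ⊛ h) n) + (tail f ⊛ (g ⊛ h)) n
      ≈⟨ +-congʳ (*-congˡ (⊛-suc g h n)) ⟨
    f 0 * (g ⊛ h) (suc n) + (tail f ⊛ (g ⊛ h)) n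
      ≈⟨ ⊛-suc f (g ⊛ h) n ⟨
    (f ⊛ (g ⊛ h)) (suc n) ∎
    where
    _*ₗ_ : Carrier → Series → Series
    (x *ₗ f) n = x * f n

  commutativeRing : CommutativeRing c ℓ
  commutativeRing = record
    { Carrier = Series
    ; _≈_ = _≈ₛ_
    ; _+_ = _⊕_
    ; _*_ = _⊛_
    ; -_ = ⊝_
    ; 0# = λ _ → 0#
    ; 1# = C 1#
    ; isCommutativeRing = record
      { isRing = record
        { +-isAbelianGroup = ⊕-isAbelianGroup
        ; *-cong = λ (coefficientwise f≐f′) (coefficientwise g≐g′) → coefficientwise (⊛-cong f≐f′ g≐g′)
        ; *-assoc = λ f g h → coefficientwise (⊛-assoc f g h)
        ; *-identity = (λ f → coefficientwise (⊛-identityˡ f))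
                     , (λ f → coefficientwise λ n → trans (⊛-comm f (C 1#) n) (⊛-identityˡ f n))
        ; distrib = (λ h f g → coefficientwise (⊛-distribˡ h f g))
                  , (λ h f g → coefficientwise (⊛-distribʳ h f g))
        }
      ; *-comm = λ f g → coefficientwise (⊛-comm f g)
      }
    }
    where
    ⊕-isAbelianGroup : IsAbelianGroup _≈ₛ_ _⊕_ (λ _ → 0#) ⊝_
    ⊕-isAbelianGroup = record
      { isGroup = record
        { isMonoid = record
          { isSemigroup = record
            { isMagma = record
              { isEquivalence = record
                { refl = coefficientwise λ n → refl
                ; sym = λ (coefficientwise f≐g) → coefficientwise λ n → sym (f≐g n)
                ; trans = λ (coefficientwise f≐g) (coefficientwise g≐h) →
                            coefficientwise λ n → trans (f≐g n) (g≐h n)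
                }
              ; ∙-cong = λ (coefficientwise f≐f′) (coefficientwise g≐g′) →
                           coefficientwise λ n → +-cong (f≐f′ n) (g≐g′ n)
              }
            ; assoc = λ f g h → coefficientwise λ n → +-assoc (f n) (g n) (h n)
            }
          ; identity = (λ f → coefficientwise λ n → +-identityˡ (f n))
                     , (λ f → coefficientwise λ n → +-identityʳ (f n))
          }
        ; inverse = (λ f → coefficientwise λ n → -‿inverseˡ (f n))
                  , (λ f → coefficientwise λ n → -‿inverseʳ (f n))
        ; ⁻¹-cong = λ (coefficientwise f≐g) → coefficientwise λ n → -‿cong (f≐g n)
        }
      ; comm = λ f g → coefficientwise λ n → +-comm (f n) (g n)
      }

  lowest-nonZeroDivisor⇒nonZeroDivisor : ∀ m g → (∀ i → i < m → g i ≈ 0#) → NonZeroDivisor R (g m) →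
                                         NonZeroDivisor commutativeRing g
  lowest-nonZeroDivisor⇒nonZeroDivisor m g below-m nzd f (coefficientwise fg≐0) =
    coefficientwise (<-rec (λ k → f k ≈ 0#) vanishes)
    where
    vanishes : ∀ k → (∀ {i} → i < k → f i ≈ 0#) → f k ≈ 0#
    vanishes k below-k = nzd (f k) (begin
      f k * g m                ≈⟨ *-congˡ (reflexive (≡.cong g (ℕ.m+n∸m≡n k m))) ⟨
      f k * g (k ℕ.+ m ∸ k)    ≈⟨ ∑-single (k ℕ.+ m) k _ (ℕ.m≤m+n k m) others ⟨
      (f ⊛ g) (k ℕ.+ m)        ≈⟨ fg≐0 (k ℕ.+ m) ⟩
      0#                       ∎)
      where
      others : ∀ i → i ≤ k ℕ.+ m → i ≢ k → f i * g (k ℕ.+ m ∸ i) ≈ 0#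
      others i i≤k+m i≢k with ℕ.<-cmp i k
      ... | tri< i<k _ _ = trans (*-congʳ (below-k i<k)) (zeroˡ _)
      ... | tri≈ _ i≡k _ = contradiction i≡k i≢k
      ... | tri> _ _ k<i = trans (*-congˡ (below-m _ k+m∸i<m)) (zeroʳ _)
        where
        k+m∸i<m : k ℕ.+ m ∸ i < m
        k+m∸i<m = ≡.subst (k ℕ.+ m ∸ i <_) (ℕ.m+n∸m≡n k m) (ℕ.∸-monoʳ-< k<i i≤k+m)

∑-pointwise : ∀ {c ℓ} (R : CommutativeRing c ℓ) n F m →
  PowerSeries.∑ (PowerSeries.commutativeRing R) n F m ≡ PowerSeries.∑ R n (λ i → F i m)
∑-pointwise R zero    F m = ≡.refl
∑-pointwise R (suc n) F m = ≡.cong (λ s → CommutativeRing._+_ R s (F (suc n) m)) (∑-pointwise R n F m)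

-- Poly is the carrier of ℤ[[w]][[v]][[u]]: the outer index is the exponent of u, the inner that of w.
module ℤ[[u,v,w]] where

  module W   = PowerSeries +-*-commutativeRing
  module VW  = PowerSeries W.commutativeRing
  module UVW = PowerSeries VW.commutativeRing

  commutativeRing : CommutativeRing _ _
  commutativeRing = UVW.commutativeRing

  open CommutativeRing commutativeRing public

  u v w : Poly
  u = UVW.X
  v = UVW.C VW.X
  w = UVW.C (VW.C W.X)

  ≋⇒≈ : ∀ {p q} → p ≋ q → p ≈ q
  ≋⇒≈ p≋q = UVW.coefficientwise λ a → VW.coefficientwise λ b → W.coefficientwise λ c → p≋q a b c

  ≈⇒≋ : ∀ {p q} → p ≈ q → p ≋ q
  ≈⇒≋ p≈q a b c = W.coefficient (VW.coefficient (UVW.coefficient p≈q a) b) c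

  sumTo≡∑ : ∀ n f → sumTo n f ≡ W.∑ n f
  sumTo≡∑ zero    f = ≡.refl
  sumTo≡∑ (suc n) f = ≡.cong (ℤ._+ f (suc n)) (sumTo≡∑ n f)

  *ₚ≋* : ∀ p q → p *ₚ q ≋ p * q
  *ₚ≋* p q a b c = begin
    (p *ₚ q) a b c
      ≡⟨ ≡.trans (sumTo≡∑ a _) (W.∑-cong a λ a₁ _ →
           ≡.trans (sumTo≡∑ b _) (W.∑-cong b λ b₁ _ → sumTo≡∑ c _)) ⟩
    W.∑ a (λ a₁ → W.∑ b λ b₁ → W.∑ c λ c₁ → p a₁ b₁ c₁ ℤ.* q (a ∸ a₁) (b ∸ b₁) (c ∸ c₁))
      ≡⟨ ≡.trans (∑-pointwise +-*-commutativeRing a _ c) (W.∑-cong a λ a₁ _ →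
           ∑-pointwise +-*-commutativeRing b _ c) ⟨
    VW.∑ a (λ a₁ → (p a₁ VW.⊛ q (a ∸ a₁)) b) c
      ≡⟨ ≡.cong (λ f → f c) (∑-pointwise W.commutativeRing a _ b) ⟨
    (p * q) a b c ∎
    where open ≡.≡-Reasoning

  u*-shift : ∀ F → u * F ≋ UVW.shift F
  u*-shift F a = ≈⇒≋ (UVW.coefficientwise (UVW.X-⊛ F)) a

  v*-shift : ∀ F → v * F ≋ λ a → VW.shift (F a)
  v*-shift F a b c = ≡.trans (W.coefficient (VW.coefficient (UVW.C-⊛ VW.X F a) b) c)
                             (W.coefficient (VW.X-⊛ (F a) b) c)

  w*-shift : ∀ F → w * F ≋ λ a b → W.shift (F a b)
  w*-shift F a b c = ≡.trans (W.coefficient (VW.coefficient (UVW.C-⊛ (VW.C W.X) F a) b) c)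
                             (≡.trans (W.coefficient (VW.C-⊛ W.X (F a) b) c) (W.X-⊛ (F a b) c))

  mono-000 : mono 0 0 0 ≋ 1#
  mono-000 zero    zero    zero    = ≡.refl
  mono-000 zero    zero    (suc c) = ≡.refl
  mono-000 zero    (suc b) c       = ≡.refl
  mono-000 (suc a) b       c       = ≡.refl

  -- The successor cases hold by computation: does (suc m ≟ suc n) reduces to does (m ≟ n).
  mono-sucᵘ : ∀ i j k → mono (suc i) j k ≋ u * mono i j k
  mono-sucᵘ i j k a b c = ≡.sym (≡.trans (u*-shift (mono i j k) a b c) (shifted a))
    where
    shifted : ∀ a → UVW.shift (mono i j k) a b c ≡ mono (suc i) j k a b c
    shifted zero    = ≡.refl
    shifted (suc a) = ≡.refl

  mono-sucᵛ : ∀ i j k → mono i (suc j) k ≋ v * mono i j k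
  mono-sucᵛ i j k a b c = ≡.sym (≡.trans (v*-shift (mono i j k) a b c) (shifted b))
    where
    shifted : ∀ b → VW.shift (mono i j k a) b c ≡ mono i (suc j) k a b c
    shifted zero    = ≡.cong (λ t → if t then 1ℤ else 0ℤ) (≡.sym (∧-zeroʳ _))
    shifted (suc b) = ≡.refl

  mono-sucʷ : ∀ i j k → mono i j (suc k) ≋ w * mono i j k
  mono-sucʷ i j k a b c = ≡.sym (≡.trans (w*-shift (mono i j k) a b c) (shifted c))
    where
    shifted : ∀ c → W.shift (mono i j k a b) c ≡ mono i j (suc k) a b c
    shifted zero    = ≡.sym (≡.trans (≡.cong (λ t → if does (a ≟ i) ∧ t then 1ℤ else 0ℤ) (∧-zeroʳ _))
                                     (≡.cong (λ t → if t then 1ℤ else 0ℤ) (∧-zeroʳ _)))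
    shifted (suc c) = ≡.refl

module MarkovNumerator where

  open import Data.Nat using (_≤_; _<_)

  shiftℕ : (ℕ → ℕ) → ℕ → ℕ
  shiftℕ f zero    = 0
  shiftℕ f (suc k) = f k

  q r : ℕ → ℕ → ℕ → ℕ → ℕ
  q zero    zero zero zero = 1
  q zero    _    _    _    = 0
  q (suc n) a    b    c    = shiftℕ (λ b′ → q n a b′ c) b ℕ.+ r (suc n) a b c
  r zero    _    _    _    = 0
  r (suc n) a    b    c    = shiftℕ (λ a′ → q n a′ b c) a ℕ.+ shiftℕ (r n a b) c

  r-u⁰ : ∀ n b c → r n 0 b c ≡ 0
  r-u⁰ zero    b c       = ≡.refl
  r-u⁰ (suc n) b zero    = ≡.refl
  r-u⁰ (suc n) b (suc c) = r-u⁰ n b c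

  q-u⁰-off : ∀ n b c → b ≢ n ⊎ c ≢ 0 → q n 0 b c ≡ 0
  q-u⁰-off zero    zero    zero    (inj₁ 0≢0) = contradiction ≡.refl 0≢0
  q-u⁰-off zero    zero    zero    (inj₂ 0≢0) = contradiction ≡.refl 0≢0
  q-u⁰-off zero    zero    (suc c) _          = ≡.refl
  q-u⁰-off zero    (suc b) c       _          = ≡.refl
  q-u⁰-off (suc n) zero    c       _          = r-u⁰ (suc n) 0 c
  q-u⁰-off (suc n) (suc b) c       off        =
    ≡.cong₂ ℕ._+_ (q-u⁰-off n b c (Sum.map₁ (λ 1+b≢1+n → 1+b≢1+n ∘ ≡.cong suc) off)) (r-u⁰ (suc n) (suc b) c)

  q-u⁰-on : ∀ n → q n 0 n 0 ≡ 1
  q-u⁰-on zero    = ≡.refl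
  q-u⁰-on (suc n) = ≡.cong₂ ℕ._+_ (q-u⁰-on n) (r-u⁰ (suc n) (suc n) 0)

  q-pos : ∀ n a b c → suc a ℕ.+ b ℕ.+ c ≡ n → 0 < q n (suc a) b c
  r-pos : ∀ n a b c → suc a ℕ.+ b ℕ.+ c ≡ n → 0 < r n (suc a) b c
  q-pos (suc n) a b c deg =
    ℕ.<-≤-trans (r-pos (suc n) a b c deg) (ℕ.m≤n+m _ (shiftℕ (λ b′ → q n (suc a) b′ c) b))
  r-pos (suc n) zero    b zero    deg rewrite ℕ.+-identityʳ b | ℕ.suc-injective deg | q-u⁰-on n = s≤s z≤n
  r-pos (suc n) zero    b (suc c) deg =
    ℕ.<-≤-trans (r-pos n 0 b c (ℕ.suc-injective (≡.trans (≡.cong suc (≡.sym (ℕ.+-suc b c))) deg)))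
                (ℕ.m≤n+m _ _)
  r-pos (suc n) (suc a) b c       deg = ℕ.<-≤-trans (q-pos n a b c (ℕ.suc-injective deg)) (ℕ.m≤m+n _ _)

  q-support : ∀ n a b c → a ℕ.+ b ℕ.+ c ≡ n → (q n a b c ≢ 0) ⇔ (1 ≤ a ⊎ b ≡ n)
  q-support n (suc a) b c deg = mk⇔ (λ _ → inj₁ (s≤s z≤n)) (λ _ → ℕ.n>0⇒n≢0 (q-pos n a b c deg))
  q-support n zero    b c deg = mk⇔ to from
    where
    to : q n 0 b c ≢ 0 → 1 ≤ 0 ⊎ b ≡ n
    to q≢0 with b ≟ n
    ... | yes b≡n = inj₂ b≡n
    ... | no  b≢n = contradiction (q-u⁰-off n b c (inj₁ b≢n)) q≢0
    from : 1 ≤ 0 ⊎ b ≡ n → q n 0 b c ≢ 0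
    from (inj₁ ())
    from (inj₂ ≡.refl) rewrite ℕ.+-cancelˡ-≡ b c 0 (≡.trans deg (≡.sym (ℕ.+-identityʳ b))) | q-u⁰-on b = λ ()

  support-condition : ∀ n a b → a ℕ.+ b ≤ n → (1 ≤ a ⊎ b ≡ n) ⇔ (n ≤ n ℕ.* a ℕ.+ b)
  support-condition n zero    b b≤n rewrite ℕ.*-zeroʳ n =
    mk⇔ (λ { (inj₁ ()) ; (inj₂ ≡.refl) → ℕ.≤-refl }) (λ n≤b → inj₂ (ℕ.≤-antisym b≤n n≤b))
  support-condition n (suc a) b _ =
    mk⇔ (λ _ → ℕ.≤-trans (ℕ.m≤m*n n (suc a)) (ℕ.m≤m+n _ b)) (λ _ → inj₁ (s≤s z≤n))

  open ℤ[[u,v,w]]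
  open import Relation.Binary.Reasoning.Setoid setoid
  open ExchangeRecurrence commutativeRing using (IsExchangeSequence; module FirstOrderSystem; exchange-unique)

  ⟦_⟧ : (ℕ → ℕ → ℕ → ℕ) → Poly
  ⟦ F ⟧ a b c = + F a b c

  Q R : ℕ → Poly
  Q n = ⟦ q n ⟧
  R n = ⟦ r n ⟧

  u*-shiftℕ : ∀ F a b c → (u * ⟦ F ⟧) a b c ≡ + shiftℕ (λ a′ → F a′ b c) a
  u*-shiftℕ F zero    b c = u*-shift ⟦ F ⟧ 0 b c
  u*-shiftℕ F (suc a) b c = u*-shift ⟦ F ⟧ (suc a) b c

  v*-shiftℕ : ∀ F a b c → (v * ⟦ F ⟧) a b c ≡ + shiftℕ (λ b′ → F a b′ c) b
  v*-shiftℕ F a zero    c = v*-shift ⟦ F ⟧ a 0 c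
  v*-shiftℕ F a (suc b) c = v*-shift ⟦ F ⟧ a (suc b) c

  w*-shiftℕ : ∀ F a b c → (w * ⟦ F ⟧) a b c ≡ + shiftℕ (F a b) c
  w*-shiftℕ F a b zero    = w*-shift ⟦ F ⟧ a b 0
  w*-shiftℕ F a b (suc c) = w*-shift ⟦ F ⟧ a b (suc c)

  Q-step : ∀ n → Q (suc n) ≈ v * Q n + R (suc n)
  Q-step n = ≋⇒≈ λ a b c → ≡.trans (ℤ.pos-+ (shiftℕ (λ b′ → q n a b′ c) b) (r (suc n) a b c))
                                    (≡.cong (ℤ._+ R (suc n) a b c) (≡.sym (v*-shiftℕ (q n) a b c)))

  R-step : ∀ n → R (suc n) ≈ u * Q n + w * R n
  R-step n = ≋⇒≈ λ a b c → ≡.trans (ℤ.pos-+ (shiftℕ (λ a′ → q n a′ b c) a) (shiftℕ (r n a b) c))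
                                    (≡.sym (≡.cong₂ ℤ._+_ (u*-shiftℕ (q n) a b c) (w*-shiftℕ (r n) a b c)))

  Q₀≈1 : Q 0 ≈ 1#
  Q₀≈1 = ≋⇒≈ Q₀≋1
    where
    Q₀≋1 : Q 0 ≋ 1#
    Q₀≋1 zero    zero    zero    = ≡.refl
    Q₀≋1 zero    zero    (suc c) = ≡.refl
    Q₀≋1 zero    (suc b) c       = ≡.refl
    Q₀≋1 (suc a) b       c       = ≡.refl

  R₀≈0 : R 0 ≈ 0#
  R₀≈0 = ≋⇒≈ λ a b c → ≡.refl

  markovTerm : ℕ → Poly
  markovTerm n = mono 1 n (suc n)

  open FirstOrderSystem {u} {v} {w} {Q} {R} Q-step R-step Q₀≈1 R₀≈0 using (Q₁≈u+v; Q-exchange)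

  Q-markov : IsExchangeSequence markovTerm Q
  Q-markov = Q-exchange {markovTerm} markovTerm₀ markovTerm-suc
    where
    markovTerm₀ : mono 1 0 1 ≈ w * u
    markovTerm₀ = begin
      mono 1 0 1            ≈⟨ ≋⇒≈ (mono-sucʷ 1 0 0) ⟩
      w * mono 1 0 0        ≈⟨ *-congˡ {w} (≋⇒≈ (mono-sucᵘ 0 0 0)) ⟩
      w * (u * mono 0 0 0)  ≈⟨ *-congˡ {w} (*-congˡ {u} (≋⇒≈ mono-000)) ⟩
      w * (u * 1#)          ≈⟨ *-congˡ {w} (*-identityʳ u) ⟩
      w * u                 ∎
    markovTerm-suc : ∀ n → mono 1 (suc n) (suc (suc n)) ≈ (v * w) * mono 1 n (suc n)
    markovTerm-suc n = begin
      mono 1 (suc n) (suc (suc n))  ≈⟨ ≋⇒≈ (mono-sucᵛ 1 n (suc (suc n))) ⟩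
      v * mono 1 n (suc (suc n))    ≈⟨ *-congˡ {v} (≋⇒≈ (mono-sucʷ 1 n (suc n))) ⟩
      v * (w * mono 1 n (suc n))    ≈⟨ *-assoc v w (mono 1 n (suc n)) ⟨
      (v * w) * mono 1 n (suc n)    ∎

  -- In the lexicographic order (u, then v, then w) the lowest term of Q n is vⁿ, with coefficient 1.
  Q-nonZeroDivisor : ∀ n → NonZeroDivisor commutativeRing (Q n)
  Q-nonZeroDivisor n =
    UVW.lowest-nonZeroDivisor⇒nonZeroDivisor 0 (Q n) (λ _ ())
      (VW.lowest-nonZeroDivisor⇒nonZeroDivisor n (Q n 0) below-vⁿ
        (W.lowest-nonZeroDivisor⇒nonZeroDivisor 0 (Q n 0 n) (λ _ ()) coefficient-vⁿ))
    where
    below-vⁿ : ∀ b → b < n → Q n 0 b W.≈ₛ λ _ → 0ℤ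
    below-vⁿ b b<n = W.coefficientwise λ c → ≡.cong +_ (q-u⁰-off n b c (inj₁ (ℕ.<⇒≢ b<n)))
    coefficient-vⁿ : NonZeroDivisor +-*-commutativeRing (Q n 0 n 0)
    coefficient-vⁿ x x*1≡0 =
      ≡.trans (≡.sym (ℤ.*-identityʳ x)) (≡.subst (λ k → x ℤ.* + k ≡ 0ℤ) (q-u⁰-on n) x*1≡0)

  markovNumerator-markov : ∀ P → IsMarkovNumerator1n P → IsExchangeSequence markovTerm P
  markovNumerator-markov P (_ , _ , recursion) n = ≋⇒≈ λ a b c →
    ≡.trans (≡.sym (*ₚ≋* (P (suc (suc n))) (P n) a b c))
            (≡.trans (recursion n a b c)
                     (≡.cong (λ s → markovTerm n a b c ℤ.+ s) (*ₚ≋* (P (suc n)) (P (suc n)) a b c)))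

  markovNumerator≋Q : ∀ P → IsMarkovNumerator1n P → ∀ n → P n ≋ Q n
  markovNumerator≋Q P H@(P₀ , P₁ , _) n =
    ≈⇒≋ (exchange-unique {markovTerm} {P} {Q} (markovNumerator-markov P H) Q-markov P₀≈Q₀ P₁≈Q₁
                         Q-nonZeroDivisor n)
    where
    P₀≈Q₀ : P 0 ≈ Q 0
    P₀≈Q₀ = begin
      P 0         ≈⟨ ≋⇒≈ P₀ ⟩
      mono 0 0 0  ≈⟨ ≋⇒≈ mono-000 ⟩
      1#          ≈⟨ Q₀≈1 ⟨
      Q 0         ∎
    P₁≈Q₁ : P 1 ≈ Q 1
    P₁≈Q₁ = begin
      P 1                               ≈⟨ ≋⇒≈ P₁ ⟩
      mono 1 0 0 + mono 0 1 0
        ≈⟨ +-cong (≋⇒≈ (mono-sucᵘ 0 0 0)) (≋⇒≈ (mono-sucᵛ 0 0 0)) ⟩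
      u * mono 0 0 0 + v * mono 0 0 0
        ≈⟨ +-cong (*-congˡ {u} (≋⇒≈ mono-000)) (*-congˡ {v} (≋⇒≈ mono-000)) ⟩
      u * 1# + v * 1#
        ≈⟨ +-cong (*-identityʳ u) (*-identityʳ v) ⟩
      u + v
        ≈⟨ Q₁≈u+v ⟨
      Q 1 ∎

  coefficient-support : ∀ P → IsMarkovNumerator1n P → ∀ n a b → a ℕ.+ b ≤ n →
    (¬ P n a b (n ∸ (a ℕ.+ b)) ≡ 0ℤ) ⇔ (n ≤ n ℕ.* a ℕ.+ b)
  coefficient-support P H n a b a+b≤n =
    support-condition n a b a+b≤n ⇔-∘ (q-support n a b c (ℕ.m+[n∸m]≡n a+b≤n) ⇔-∘ P≢0⇔q≢0)
    where
    c : ℕ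
    c = n ∸ (a ℕ.+ b)
    P≡q : P n a b c ≡ + q n a b c
    P≡q = markovNumerator≋Q P H n a b c
    P≢0⇔q≢0 : (¬ P n a b c ≡ 0ℤ) ⇔ (q n a b c ≢ 0)
    P≢0⇔q≢0 = mk⇔ (λ P≢0 q≡0 → P≢0 (≡.trans P≡q (≡.cong +_ q≡0)))
                  (λ q≢0 P≡0 → q≢0 (ℤ.+-injective (≡.trans (≡.sym P≡q) P≡0)))

open MarkovNumerator using (coefficient-support)

open import Data.Integer using (_+_; _*_; _≤_)

corollary5p3 : (P : ℕ → Poly) → IsMarkovNumerator1n P →
    (n : ℕ) → 1 Data.Nat.≤ n → (i j : ℤ) →
    (¬ (coeffA P n i j ≡ 0ℤ)) ⇔
      (0ℤ ≤ i × 0ℤ ≤ j × + n ≤ + n * i + j × i + j ≤ + n)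
corollary5p3 P H n _ -[1+ _ ] j        = mk⇔ (contradiction ≡.refl) λ { (() , _) }
corollary5p3 P H n _ (+ i)    -[1+ _ ] = mk⇔ (contradiction ≡.refl) λ { (_ , () , _) }
corollary5p3 P H n _ (+ i)    (+ j) with i ℕ.+ j ℕ.≤? n
... | no i+j≰n = mk⇔ (contradiction ≡.refl) λ (_ , _ , _ , i+j≤n) _ →
  i+j≰n (ℤ.drop‿+≤+ (≡.subst (_≤ + n) (≡.sym (ℤ.pos-+ i j)) i+j≤n))
... | yes i+j≤n rewrite ≡.sym (ℤ.pos-* n i) | ≡.sym (ℤ.pos-+ (n ℕ.* i) j) | ≡.sym (ℤ.pos-+ i j) =
  mk⇔ (λ P≢0 → +≤+ z≤n , +≤+ z≤n , +≤+ (Equivalence.to support P≢0) , +≤+ i+j≤n)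
      (λ { (_ , _ , +≤+ n≤ni+j , _) → Equivalence.from support n≤ni+j })
  where
  support : (¬ P n i j (n ∸ (i ℕ.+ j)) ≡ 0ℤ) ⇔ (n ℕ.≤ n ℕ.* i ℕ.+ j)
  support = coefficient-support P H n i j i+j≤n
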